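{- Let $k\ge 1$, $s\ge 2$, $m>0$ be integers with $n=ks+m\ge 5$, let $F$ be a field, $\mathfrak P=PG(n-2,F)$, $q_0,\dots,q_{n-1}$ a projective frame of $\mathfrak P$, and $X=\{0,\dots,n-1\}$. Consider the map $c\mapsto p_c$ on the points (the $(k+m)$-subsets of $X$) of $\mathbf{CR}(X,k,s)$. (i) If the characteristic of $F$ does not divide $s-1$ (i.e. $(s-1)\cdot 1_F\ne 0$), then $p$ does not map the blocks of $\mathbf{CR}(X,k,s)$ onto $(s-2)$-dimensional subspaces: there is a block $B$ such that the subspace spanned by $\{p_c:c\in B\}$ does not have projective dimension $s-2$. (ii) If the characteristic of $F$ divides $s-1$ (i.e. $(s-1)\cdot 1_F=0$), then for every block $B$ the subspace spanned by $\{p_c:c\in B\}$ has projective dimension $s-2$, so $p$ is a representation of $\mathbf{CR}(X,k,s)$ in $PG(n-2,F)$ with blocks represented by $(s-2)$-subspaces.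
   Context: For $u\subseteq X$, $Q_u$ is the projective subspace spanned by $\{q_i:i\in u\}$; for every nonempty proper $a\subset X$, $Q_a\cap Q_{X\setminus a}$ is a single point, denoted $p_a$. $\mathbf{CR}(X,k,s)$ is the incidence structure whose points are the $(k+m)$-element subsets of $X$ and whose blocks are the sets $\{a_1\cup d,\dots,a_s\cup d\}$, where $a_1,\dots,a_s$ are pairwise disjoint $k$-subsets of $X$ and $d$ is an $m$-subset of $X$ disjoint from all $a_i$. Dimensions are projective dimensions. -}

module Defs where

open import Level using (Level; _⊔_) renaming (suc to lsuc)
open import Data.Nat using (ℕ; zero; suc)
open import Data.Fin using (Fin; zero; suc)
open import Data.Fin.Subset using (Subset; _∉_; ∁; _∩_; ∣_∣) renaming (⊥ to ∅)
open import Data.Product using (Σ; _×_)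
open import Relation.Nullary using (¬_)
open import Relation.Binary.PropositionalEquality using (_≡_; _≢_)
open import Algebra.Bundles using (CommutativeRing)

record Field (c ℓ : Level) : Set (lsuc (c ⊔ ℓ)) where
  field
    commutativeRing : CommutativeRing c ℓ
  open CommutativeRing commutativeRing public
  field
    1≉0     : ¬ (1# ≈ 0#)
    inverse : ∀ x → ¬ (x ≈ 0#) → Σ Carrier (λ y → (x * y) ≈ 1#)

module LinAlg {c ℓ : Level} (F : Field c ℓ) where
  open Field F using (Carrier; _≈_; _+_; _*_; 0#; 1#)

  natMul : ℕ → Carrier
  natMul zero    = 0#
  natMul (suc n) = 1# + natMul n

  CharDivides : ℕ → Set ℓ
  CharDivides r = natMul r ≈ 0#

  sumF : (r : ℕ) → (Fin r → Carrier) → Carrier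
  sumF zero    f = 0#
  sumF (suc r) f = f zero + sumF r (λ i → f (suc i))

  Vect : ℕ → Set c
  Vect d = Fin d → Carrier

  _≈ᵥ_ : {d : ℕ} → Vect d → Vect d → Set ℓ
  u ≈ᵥ v = ∀ t → u t ≈ v t

  0ᵥ : {d : ℕ} → Vect d
  0ᵥ t = 0#

  lincomb : {d r : ℕ} → (Fin r → Carrier) → (Fin r → Vect d) → Vect d
  lincomb {d} {r} coef w t = sumF r (λ i → coef i * w i t)

  InSpan : {d r : ℕ} → (Fin r → Vect d) → Vect d → Set (c ⊔ ℓ)
  InSpan {d} {r} w x = Σ (Fin r → Carrier) (λ coef → x ≈ᵥ lincomb coef w)

  LinIndep : {d r : ℕ} → (Fin r → Vect d) → Set (c ⊔ ℓ)
  LinIndep {d} {r} w = ∀ (coef : Fin r → Carrier) → lincomb coef w ≈ᵥ 0ᵥ → ∀ i → coef i ≈ 0#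

  HasVecDim : {d r : ℕ} → (Fin r → Vect d) → ℕ → Set (c ⊔ ℓ)
  HasVecDim {d} w e =
    Σ (Fin e → Vect d) (λ b → ((∀ j → InSpan w (b j)) × LinIndep b) × (∀ i → InSpan b (w i)))

  HasProjDim : {d r : ℕ} → (Fin r → Vect d) → ℕ → Set (c ⊔ ℓ)
  HasProjDim w e = HasVecDim w (suc e)

  -- q_0,…,q_{n-1} (vectors in F^d) form a projective frame: any n-1 of them
  -- (i.e. all but q_j) are linearly independent (used with d = n-1).
  IsFrame : {d n : ℕ} → (Fin n → Vect d) → Set (c ⊔ ℓ)
  IsFrame {d} {n} q = ∀ (j : Fin n) (coef : Fin n → Carrier) →
    coef j ≈ 0# → lincomb coef q ≈ᵥ 0ᵥ → ∀ i → coef i ≈ 0#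

  InQ : {d n : ℕ} → (Fin n → Vect d) → Subset n → Vect d → Set (c ⊔ ℓ)
  InQ {d} {n} q u x = Σ (Fin n → Carrier) (λ coef → (∀ i → i ∉ u → coef i ≈ 0#) × (x ≈ᵥ lincomb coef q))

  -- x is a (nonzero) vector representing the point p_a = Q_a ∩ Q_{X∖a}
  RepresentsP : {d n : ℕ} → (Fin n → Vect d) → Subset n → Vect d → Set (c ⊔ ℓ)
  RepresentsP q a x = (¬ (x ≈ᵥ 0ᵥ)) × (InQ q a x × InQ q (∁ a) x)

-- A block of CR(X,k,s) with X = Fin n: pairwise disjoint k-subsets a_1..a_s and an
-- m-subset d disjoint from all a_i; the block is {a_i ∪ d : i}.
record Block (n k s m : ℕ) : Set where
  field
    a        : Fin s → Subset n
    d        : Subset n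
    a-size   : ∀ i → ∣ a i ∣ ≡ k
    d-size   : ∣ d ∣ ≡ m
    a-disj   : ∀ i j → i ≢ j → (a i ∩ a j) ≡ ∅
    ad-disj  : ∀ i → (a i ∩ d) ≡ ∅

module Submission where

-- Any n-1 vectors of the frame q are independent, so the relations Σ g_i q_i = 0 form a
-- line: two relations are proportional and a nonzero one, ρ, has no zero coordinate.
-- A representative x of p_u lies in Q_u and Q_{X∖u}; the difference of the two
-- expressions is a relation, so x = t·P(u) with t ≠ 0 and P(u) = Σ_{i∈u} ρ_i q_i.
-- For a block with members c_j = a_j ∪ d, Σ_j y_j P(c_j) = Σ_i σ_i ρ_i q_i where
-- σ_i = Σ_{j : i ∈ c_j} y_j; if this vanishes, σ is constant, and comparing its values on
-- a_j and on d gives y_j = Σ_j y_j for all j ("balanced").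
--  (i)  If (s-1)·1 ≠ 0, balanced numbers vanish, so the s points of any block (e.g. of
--       the standard block) are independent and their span is not (s-2)-dimensional.
--  (ii) If (s-1)·1 = 0, each i ∈ X lies in 1 ≡ s members, so Σ_j P(c_j) = 0; together
--       with balancing, the last s-1 points form a basis of the span.

open import Defs
open import Level using (Level; _⊔_)
open import Data.Nat using (ℕ; zero; suc; _∸_; _≤_; _<_; s≤s; z≤n)
import Data.Nat.Properties as ℕ
open import Data.Fin using (Fin; zero; suc; punchIn; _≟_)
open import Data.Fin.Properties using (punchInᵢ≢i; suc-injective)
open import Data.Fin.Subset
  using (Subset; inside; outside; _∈_; _∉_; _∩_; _∪_; ∣_∣; ⊤; ⁅_⁆; Nonempty)
  renaming (⊥ to ∅)
open import Data.Fin.Subset.Properties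
  using (_∈?_; x∈p∩q⁺; x∈p∩q⁻; x∈p∪q⁺; x∈p∪q⁻; x∈p⇒x∉∁p; ∉⊥; ∈⊤; ∣p∣≡n⇒p≡⊤; ∣⊥∣≡0; ∣⊤∣≡n;
         ∣⁅x⁆∣≡1; x∈⁅y⁆⇒x≡y; nonempty?; Empty-unique; ∩-zeroˡ; ∩-zeroʳ)
open import Data.Vec using ([]; _∷_; _++_; concat; replicate; here; there)
open import Data.Vec.Properties using (zipWith-++)
open import Data.Vec.Functional using (insertAt)
open import Data.Vec.Functional.Properties using (insertAt-lookup; insertAt-punchIn)
open import Data.Product using (Σ; _×_; _,_; proj₁; proj₂)
open import Data.Sum using (_⊎_; inj₁; inj₂)
open import Data.Empty using (⊥-elim)
open import Relation.Nullary using (¬_; Dec; yes; no; contradiction)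
import Relation.Binary.PropositionalEquality as ≡
open ≡ using (_≡_; _≢_)
open import Function using (_∘_)

module LinearAlgebra {c ℓ : Level} (F : Field c ℓ) where
  open Field F hiding (zero)
  open LinAlg F
  open import Algebra.Properties.Ring ring
    using (-‿distribʳ-*; -1*x≈-x; x∙y⁻¹≈ε⇒x≈y; x≈y⇒x∙y⁻¹≈ε; x[y-z]≈xy-xz; [y-z]x≈yx-zx)
  open import Algebra.Properties.Semiring.Sum semiring public
    using (sum; sum-cong-≋; sum-replicate-zero; sum-remove; ∑-comm; ∑-distrib-+;
           *-distribˡ-sum; *-distribʳ-sum)
  open import Algebra.Solver.Ring.NaturalCoefficients.Default commutativeSemiring
  open import Relation.Binary.Reasoning.Setoid setoid

  *-zero-cancelˡ : ∀ {a b} → ¬ a ≈ 0# → a * b ≈ 0# → b ≈ 0#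
  *-zero-cancelˡ {a} {b} a≉0 ab≈0 with inverse a a≉0
  ... | a⁻¹ , aa⁻¹≈1 = begin
    b               ≈⟨ sym (*-identityˡ b) ⟩
    1# * b          ≈⟨ *-congʳ (sym aa⁻¹≈1) ⟩
    (a * a⁻¹) * b   ≈⟨ solve 3 (λ a a⁻¹ b → (a :* a⁻¹) :* b := a⁻¹ :* (a :* b)) refl a a⁻¹ b ⟩
    a⁻¹ * (a * b)   ≈⟨ *-congˡ ab≈0 ⟩
    a⁻¹ * 0#        ≈⟨ zeroʳ a⁻¹ ⟩
    0#              ∎

  *-nonzero : ∀ {a b} → ¬ a ≈ 0# → ¬ b ≈ 0# → ¬ a * b ≈ 0#
  *-nonzero a≉0 b≉0 ab≈0 = b≉0 (*-zero-cancelˡ a≉0 ab≈0)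

  *-cancelˡ : ∀ {a b b′} → ¬ a ≈ 0# → a * b ≈ a * b′ → b ≈ b′
  *-cancelˡ {a} {b} {b′} a≉0 ab≈ab′ = x∙y⁻¹≈ε⇒x≈y b b′ (*-zero-cancelˡ a≉0 (begin
    a * (b + - b′)       ≈⟨ x[y-z]≈xy-xz a b b′ ⟩
    a * b + - (a * b′)   ≈⟨ x≈y⇒x∙y⁻¹≈ε ab≈ab′ ⟩
    0#                   ∎))

  inverse-nonzero : ∀ {a a⁻¹} → a * a⁻¹ ≈ 1# → ¬ a⁻¹ ≈ 0#
  inverse-nonzero {a} aa⁻¹≈1 a⁻¹≈0 = 1≉0 (trans (sym aa⁻¹≈1) (trans (*-congˡ a⁻¹≈0) (zeroʳ a)))

  iverson : ∀ {p} {P : Set p} → Dec P → Carrier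
  iverson (yes _) = 1#
  iverson (no _)  = 0#

  iverson-yes : ∀ {p} {P : Set p} → P → (P? : Dec P) → iverson P? ≈ 1#
  iverson-yes _ (yes _) = refl
  iverson-yes p (no ¬p) = contradiction p ¬p

  iverson-no : ∀ {p} {P : Set p} → ¬ P → (P? : Dec P) → iverson P? ≈ 0#
  iverson-no ¬p (yes p) = contradiction p ¬p
  iverson-no _  (no _)  = refl

  sumF≡sum : ∀ r (f : Fin r → Carrier) → sumF r f ≡ sum f
  sumF≡sum zero    f = ≡.refl
  sumF≡sum (suc r) f = ≡.cong (f zero +_) (sumF≡sum r (f ∘ suc))

  sum-zero : ∀ {r} {f : Fin r → Carrier} → (∀ i → f i ≈ 0#) → sum f ≈ 0#
  sum-zero {r} f≈0 = trans (sum-cong-≋ f≈0) (sum-replicate-zero r)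

  sum-single : ∀ {r} {f : Fin r → Carrier} (j : Fin r) → (∀ i → i ≢ j → f i ≈ 0#) → sum f ≈ f j
  sum-single {suc r} {f} j f≈0 = begin
    sum f                               ≈⟨ sum-remove {i = j} f ⟩
    f j + sum (λ i → f (punchIn j i))   ≈⟨ +-congˡ (sum-zero (λ i → f≈0 (punchIn j i) (punchInᵢ≢i j i))) ⟩
    f j + 0#                            ≈⟨ +-identityʳ (f j) ⟩
    f j                                 ∎

  sum-const : ∀ r a → sum {r} (λ _ → a) ≈ natMul r * a
  sum-const zero    a = sym (zeroˡ a)
  sum-const (suc r) a = trans (+-cong (sym (*-identityˡ a)) (sum-const r a)) (sym (distribʳ a 1# (natMul r)))

  sum-sub : ∀ {r} (f g : Fin r → Carrier) → sum (λ i → f i + - g i) ≈ sum f + - sum g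
  sum-sub f g = begin
    sum (λ i → f i + - g i)      ≈⟨ ∑-distrib-+ f (λ i → - g i) ⟩
    sum f + sum (λ i → - g i)    ≈⟨ +-congˡ (sum-cong-≋ (λ i → sym (-1*x≈-x (g i)))) ⟩
    sum f + sum (λ i → - 1# * g i) ≈⟨ +-congˡ (sym (*-distribˡ-sum (- 1#) g)) ⟩
    sum f + - 1# * sum g         ≈⟨ +-congˡ (-1*x≈-x (sum g)) ⟩
    sum f + - sum g              ∎

  lincomb-cong : ∀ {d r} {α β : Fin r → Carrier} (w : Fin r → Vect d) →
                 (∀ i → α i ≈ β i) → lincomb α w ≈ᵥ lincomb β w
  lincomb-cong {r = r} w α≈β t = sumF-cong r (λ i → *-congʳ (α≈β i))
    where
    sumF-cong : ∀ r {f g : Fin r → Carrier} → (∀ i → f i ≈ g i) → sumF r f ≈ sumF r g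
    sumF-cong zero    f≈g = refl
    sumF-cong (suc r) f≈g = +-cong (f≈g zero) (sumF-cong r (f≈g ∘ suc))

  lincomb-zero : ∀ {d r} {α : Fin r → Carrier} (w : Fin r → Vect d) → (∀ i → α i ≈ 0#) → lincomb α w ≈ᵥ 0ᵥ
  lincomb-zero {r = r} {α} w α≈0 t = begin
    lincomb α w t                ≡⟨ sumF≡sum r _ ⟩
    sum (λ i → α i * w i t)      ≈⟨ sum-zero (λ i → trans (*-congʳ (α≈0 i)) (zeroˡ (w i t))) ⟩
    0#                           ∎

  lincomb-scale : ∀ {d r} a (α : Fin r → Carrier) (w : Fin r → Vect d) t →
                  lincomb (λ i → a * α i) w t ≈ a * lincomb α w t
  lincomb-scale {r = r} a α w t = begin
    lincomb (λ i → a * α i) w t   ≡⟨ sumF≡sum r _ ⟩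
    sum (λ i → a * α i * w i t)   ≈⟨ sum-cong-≋ (λ i → *-assoc a (α i) (w i t)) ⟩
    sum (λ i → a * (α i * w i t)) ≈⟨ sym (*-distribˡ-sum a (λ i → α i * w i t)) ⟩
    a * sum (λ i → α i * w i t)   ≡⟨ ≡.cong (a *_) (≡.sym (sumF≡sum r _)) ⟩
    a * lincomb α w t             ∎

  lincomb-sub : ∀ {d r} (α β : Fin r → Carrier) (w : Fin r → Vect d) t →
                lincomb (λ i → α i + - β i) w t ≈ lincomb α w t + - lincomb β w t
  lincomb-sub {r = r} α β w t = begin
    lincomb (λ i → α i + - β i) w t                   ≡⟨ sumF≡sum r _ ⟩
    sum (λ i → (α i + - β i) * w i t)                 ≈⟨ sum-cong-≋ (λ i → [y-z]x≈yx-zx (w i t) (α i) (β i)) ⟩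
    sum (λ i → α i * w i t + - (β i * w i t))         ≈⟨ sum-sub (λ i → α i * w i t) (λ i → β i * w i t) ⟩
    sum (λ i → α i * w i t) + - sum (λ i → β i * w i t) ≡⟨ ≡.cong₂ (λ x y → x + - y) (≡.sym (sumF≡sum r _)) (≡.sym (sumF≡sum r _)) ⟩
    lincomb α w t + - lincomb β w t                   ∎

  lincomb-lincomb : ∀ {d r e} (x : Fin e → Carrier) (α : Fin e → Fin r → Carrier) (w : Fin r → Vect d) t →
                    sum (λ j → x j * lincomb (α j) w t) ≈ lincomb (λ i → sum (λ j → x j * α j i)) w t
  lincomb-lincomb {r = r} {e} x α w t = begin
    sum (λ j → x j * lincomb (α j) w t)           ≈⟨ sum-cong-≋ {e} (λ j → *-congˡ (reflexive (sumF≡sum r (λ i → α j i * w i t)))) ⟩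
    sum (λ j → x j * sum (λ i → α j i * w i t))   ≈⟨ sum-cong-≋ (λ j → *-distribˡ-sum (x j) (λ i → α j i * w i t)) ⟩
    sum (λ j → sum (λ i → x j * (α j i * w i t))) ≈⟨ ∑-comm (λ j i → x j * (α j i * w i t)) ⟩
    sum (λ i → sum (λ j → x j * (α j i * w i t))) ≈⟨ sum-cong-≋ (λ i → sum-cong-≋ {e} (λ j → sym (*-assoc (x j) (α j i) (w i t)))) ⟩
    sum (λ i → sum (λ j → x j * α j i * w i t))   ≈⟨ sum-cong-≋ (λ i → sym (*-distribʳ-sum (w i t) (λ j → x j * α j i))) ⟩
    sum (λ i → sum (λ j → x j * α j i) * w i t)   ≡⟨ ≡.sym (sumF≡sum r _) ⟩
    lincomb (λ i → sum (λ j → x j * α j i)) w t   ∎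

  unit : ∀ {r} → Fin r → Fin r → Carrier
  unit j i = iverson (i ≟ j)

  member-in-span : ∀ {d r} (w : Fin r → Vect d) j → InSpan w (w j)
  member-in-span {r = r} w j = unit j , λ t → sym (begin
    lincomb (unit j) w t           ≡⟨ sumF≡sum r _ ⟩
    sum (λ i → unit j i * w i t)   ≈⟨ sum-single j (λ i i≢j → trans (*-congʳ (iverson-no i≢j (i ≟ j))) (zeroˡ _)) ⟩
    unit j j * w j t               ≈⟨ *-congʳ (iverson-yes ≡.refl (j ≟ j)) ⟩
    1# * w j t                     ≈⟨ *-identityˡ (w j t) ⟩
    w j t                          ∎)

  OnlyTrivialSolution : ∀ {e r} → (Fin e → Fin r → Carrier) → Set (c ⊔ ℓ)
  OnlyTrivialSolution {r = r} A =
    ∀ (x : Fin r → Carrier) → (∀ j → sum (λ i → A j i * x i) ≈ 0#) → ∀ i → x i ≈ 0#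

  -- Double negation commutes with finite conjunctions. Equality in F is not decidable, so
  -- this is what allows a case split "row zero / some pivot" when proving a negation.
  ¬¬-∀-Fin : ∀ {p r} {P : Fin r → Set p} → (∀ i → ¬ ¬ P i) → ¬ ¬ (∀ i → P i)
  ¬¬-∀-Fin {r = zero}  ¬¬P ¬∀P = ¬∀P (λ ())
  ¬¬-∀-Fin {r = suc r} ¬¬P ¬∀P =
    ¬¬P zero (λ P0 → ¬¬-∀-Fin (¬¬P ∘ suc) (λ Psuc → ¬∀P (λ { zero → P0 ; (suc i) → Psuc i })))

  drop-zero-equation : ∀ {e r} {A : Fin (suc e) → Fin r → Carrier} →
    (∀ i → A zero i ≈ 0#) → OnlyTrivialSolution A → OnlyTrivialSolution (A ∘ suc)
  drop-zero-equation A₀≈0 trivial x solves = trivial x λ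
    { zero    → sum-zero (λ i → trans (*-congʳ (A₀≈0 i)) (zeroˡ _))
    ; (suc j) → solves j }

  -- Gaussian elimination: a pivot A zero c with inverse y eliminates the unknown c from
  -- the other equations, and uniqueness of solutions passes to the reduced system.
  module Pivot {e r} (A : Fin (suc e) → Fin (suc r) → Carrier) (c : Fin (suc r))
               {y : Carrier} (pivot : A zero c * y ≈ 1#) where

    -- multiple of the pivot row subtracted from equation j
    factor : Fin e → Carrier
    factor j = A (suc j) c * y

    reduced : Fin e → Fin r → Carrier
    reduced j i = A (suc j) (punchIn c i) + - (factor j * A zero (punchIn c i))

    -- A vector x′ of the remaining unknowns, extended by the value v of unknown c that
    -- solves the pivot equation.
    module Extension (x′ : Fin r → Carrier) where
      S : Carrier
      S = sum (λ i → A zero (punchIn c i) * x′ i)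

      v : Carrier
      v = - (y * S)

      x : Fin (suc r) → Carrier
      x = insertAt x′ c v

      split : ∀ j → sum (λ i → A j i * x i) ≈ A j c * v + sum (λ i → A j (punchIn c i) * x′ i)
      split j = trans (sum-remove {i = c} (λ i → A j i * x i))
        (+-cong (reflexive (≡.cong (A j c *_) (insertAt-lookup x′ c v)))
                (sum-cong-≋ (λ i → reflexive (≡.cong (A j (punchIn c i) *_) (insertAt-punchIn x′ c v i)))))

      scaled : ∀ b → b * v ≈ - (b * y * S)
      scaled b = trans (sym (-‿distribʳ-* b (y * S))) (-‿cong (sym (*-assoc b y S)))

      solves-pivot-equation : sum (λ i → A zero i * x i) ≈ 0#
      solves-pivot-equation = begin
        sum (λ i → A zero i * x i)   ≈⟨ split zero ⟩
        A zero c * v + S             ≈⟨ +-congʳ (trans (scaled (A zero c)) (-‿cong (*-congʳ pivot))) ⟩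
        - (1# * S) + S               ≈⟨ +-congʳ (-‿cong (*-identityˡ S)) ⟩
        - S + S                      ≈⟨ -‿inverseˡ S ⟩
        0#                           ∎

      other-equation : ∀ j → sum (λ i → A (suc j) i * x i) ≈ sum (λ i → reduced j i * x′ i)
      other-equation j = begin
        sum (λ i → A (suc j) i * x i)                     ≈⟨ split (suc j) ⟩
        A (suc j) c * v + sum (λ i → u i * x′ i)          ≈⟨ +-comm _ _ ⟩
        sum (λ i → u i * x′ i) + A (suc j) c * v          ≈⟨ +-congˡ (scaled (A (suc j) c)) ⟩
        sum (λ i → u i * x′ i) + - (factor j * S)         ≈⟨ +-congˡ (-‿cong (*-distribˡ-sum (factor j) (λ i → p i * x′ i))) ⟩
        sum (λ i → u i * x′ i) + - sum (λ i → factor j * (p i * x′ i))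
                                                          ≈⟨ sym (sum-sub (λ i → u i * x′ i) (λ i → factor j * (p i * x′ i))) ⟩
        sum (λ i → u i * x′ i + - (factor j * (p i * x′ i))) ≈⟨ sum-cong-≋ (λ i → sym (row-combination i)) ⟩
        sum (λ i → reduced j i * x′ i)                    ∎
        where
        u p : Fin r → Carrier
        u i = A (suc j) (punchIn c i)
        p i = A zero (punchIn c i)
        row-combination : ∀ i → reduced j i * x′ i ≈ u i * x′ i + - (factor j * (p i * x′ i))
        row-combination i = trans ([y-z]x≈yx-zx (x′ i) (u i) _) (+-congˡ (-‿cong (*-assoc (factor j) (p i) (x′ i))))

    -- If x′ solves the reduced system, its extension solves the original one, hence is 0.
    eliminate : OnlyTrivialSolution A → OnlyTrivialSolution reduced
    eliminate trivial x′ solves′ i =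
      trans (reflexive (≡.sym (insertAt-punchIn x′ c v i))) (trivial x solves (punchIn c i))
      where
      open Extension x′
      solves : ∀ j → sum (λ i → A j i * x i) ≈ 0#
      solves zero    = solves-pivot-equation
      solves (suc j) = trans (other-equation j) (solves′ j)

  -- A homogeneous system with fewer equations than unknowns has a nontrivial solution,
  -- in the constructive form: it does not have only the trivial one.
  underdetermined : ∀ {e r} → e < r → (A : Fin e → Fin r → Carrier) → ¬ OnlyTrivialSolution A
  underdetermined {zero}  {suc r} _ A trivial = 1≉0 (trivial (λ _ → 1#) (λ ()) zero)
  underdetermined {suc e} {suc r} (s≤s e<r) A trivial = ¬¬-∀-Fin pivot-case zero-row-case
    where
    zero-row-case : ¬ (∀ i → A zero i ≈ 0#)
    zero-row-case A₀≈0 =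
      underdetermined (ℕ.m<n⇒m<1+n e<r) (A ∘ suc) (drop-zero-equation {A = A} A₀≈0 trivial)
    pivot-case : ∀ c → ¬ ¬ A zero c ≈ 0#
    pivot-case c A₀c≉0 with inverse (A zero c) A₀c≉0
    ... | y , pivot = underdetermined e<r (Pivot.reduced A c pivot) (Pivot.eliminate A c pivot trivial)

  independent-not-spanned : ∀ {d e r} → e < r → (w : Fin r → Vect d) (b : Fin e → Vect d) →
    LinIndep w → ¬ (∀ i → InSpan b (w i))
  independent-not-spanned {r = r} e<r w b independent inSpan =
    underdetermined e<r (λ j i → M i j) trivial
    where
    M : Fin r → Fin _ → Carrier
    M i = proj₁ (inSpan i)
    trivial : OnlyTrivialSolution (λ j i → M i j)
    trivial x solves = independent x λ t → begin
      lincomb x w t                                  ≡⟨ sumF≡sum r _ ⟩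
      sum (λ i → x i * w i t)                        ≈⟨ sum-cong-≋ (λ i → *-congˡ (proj₂ (inSpan i) t)) ⟩
      sum (λ i → x i * lincomb (M i) b t)            ≈⟨ lincomb-lincomb x M b t ⟩
      lincomb (λ j → sum (λ i → x i * M i j)) b t    ≈⟨ lincomb-zero b (λ j → trans (sum-cong-≋ (λ i → *-comm (x i) (M i j))) (solves j)) t ⟩
      0#                                             ∎

  independent⇒¬HasVecDim : ∀ {d e r} {w : Fin r → Vect d} → e < r → LinIndep w → ¬ HasVecDim w e
  independent⇒¬HasVecDim e<r independent (b , _ , w-in-span-b) =
    independent-not-spanned e<r _ b independent w-in-span-b

module FrameRelations {c ℓ : Level} (F : Field c ℓ) {d n : ℕ}
                      (q : Fin n → LinAlg.Vect F d) (frame : LinAlg.IsFrame F q) where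
  open Field F hiding (zero)
  open LinAlg F
  open LinearAlgebra F
  open import Algebra.Properties.Ring ring using (-0#≈0#; x∙y⁻¹≈ε⇒x≈y; x≈y⇒x∙y⁻¹≈ε)
  open import Algebra.Solver.Ring.NaturalCoefficients.Default commutativeSemiring
  open import Relation.Binary.Reasoning.Setoid setoid

  IsRelation : (Fin n → Carrier) → Set ℓ
  IsRelation g = lincomb g q ≈ᵥ 0ᵥ

  -- Any n-1 frame vectors are independent, so the relations form a line: any two
  -- relations g, h are proportional, g_r h_i = h_r g_i. (The combination g_r h - h_r g
  -- is a relation vanishing at r, hence zero.)
  relations-proportional : ∀ {g h} → IsRelation g → IsRelation h → ∀ r i → g r * h i ≈ h r * g i
  relations-proportional {g} {h} g-rel h-rel r i =
    x∙y⁻¹≈ε⇒x≈y _ _ (frame r coef (x≈y⇒x∙y⁻¹≈ε (*-comm (g r) (h r))) coef-rel i)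
    where
    coef : Fin n → Carrier
    coef i = g r * h i + - (h r * g i)
    coef-rel : IsRelation coef
    coef-rel t = begin
      lincomb coef q t                                                 ≈⟨ lincomb-sub (λ i → g r * h i) (λ i → h r * g i) q t ⟩
      lincomb (λ i → g r * h i) q t + - lincomb (λ i → h r * g i) q t  ≈⟨ +-cong (lincomb-scale (g r) h q t) (-‿cong (lincomb-scale (h r) g q t)) ⟩
      g r * lincomb h q t + - (h r * lincomb g q t)                    ≈⟨ +-cong (*-congˡ (h-rel t)) (-‿cong (*-congˡ (g-rel t))) ⟩
      g r * 0# + - (h r * 0#)                                          ≈⟨ +-cong (zeroʳ (g r)) (-‿cong (zeroʳ (h r))) ⟩
      0# + - 0#                                                        ≈⟨ -‿inverseʳ 0# ⟩
      0#                                                               ∎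

  indicator : Subset n → Fin n → Carrier
  indicator u i = iverson (i ∈? u)

  -- A representative x of p_u = Q_u ∩ Q_{X∖u} is written as x = Σ_{i∈u} α_i q_i and as
  -- x = Σ_{i∉u} β_i q_i; then g = α - β is a relation, x = Σ_{i∈u} g_i q_i, and g has no
  -- zero coordinate (otherwise g = 0 by the frame property, so α = 0 and x = 0).
  representative-relation : ∀ {u x} → RepresentsP q u x →
    Σ (Fin n → Carrier) λ g → IsRelation g × (∀ i → ¬ g i ≈ 0#) × (x ≈ᵥ lincomb (λ i → indicator u i * g i) q)
  representative-relation {u} {x} (x≉0 , (α , α-supp , x≈α) , (β , β-supp , x≈β)) =
    g , g-rel , g-nonzero , (λ t → trans (x≈α t) (lincomb-cong q α≈restricted-g t))
    where
    g : Fin n → Carrier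
    g i = α i + - β i
    g-rel : IsRelation g
    g-rel t = trans (lincomb-sub α β q t) (x≈y⇒x∙y⁻¹≈ε (trans (sym (x≈α t)) (x≈β t)))
    α≈restricted-g : ∀ i → α i ≈ indicator u i * g i
    α≈restricted-g i with i ∈? u
    ... | yes i∈u = sym (begin
      1# * (α i + - β i)   ≈⟨ *-identityˡ _ ⟩
      α i + - β i          ≈⟨ +-congˡ (trans (-‿cong (β-supp i (x∈p⇒x∉∁p i∈u))) -0#≈0#) ⟩
      α i + 0#             ≈⟨ +-identityʳ (α i) ⟩
      α i                  ∎)
    ... | no i∉u = trans (α-supp i i∉u) (sym (zeroˡ (g i)))
    g-nonzero : ∀ r → ¬ g r ≈ 0#
    g-nonzero r gr≈0 = x≉0 (λ t → trans (x≈α t) (lincomb-zero q α≈0 t))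
      where
      α≈0 : ∀ i → α i ≈ 0#
      α≈0 i = trans (α≈restricted-g i) (trans (*-congˡ (frame r g gr≈0 g-rel i)) (zeroʳ _))

  module Normalised {ρ : Fin n → Carrier} (ρ-rel : IsRelation ρ) (ρ-nonzero : ∀ i → ¬ ρ i ≈ 0#) where

    canonical : Subset n → Vect d
    canonical u = lincomb (λ i → indicator u i * ρ i) q

    -- Every representative of p_u is a nonzero multiple of P(u) (o is any index, used to
    -- compare the relation of the representative with ρ).
    representative-multiple : ∀ {u x} → Fin n → RepresentsP q u x →
      Σ Carrier λ t → ¬ t ≈ 0# × (∀ t′ → x t′ ≈ t * canonical u t′)
    representative-multiple {u} {x} o represents with representative-relation represents | inverse (ρ o) (ρ-nonzero o)
    ... | g , g-rel , g-nonzero , x≈g | ρo⁻¹ , ρoρo⁻¹≈1 =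
      t , *-nonzero (g-nonzero o) (inverse-nonzero ρoρo⁻¹≈1) , λ t′ → begin
        x t′                                     ≈⟨ x≈g t′ ⟩
        lincomb (λ i → indicator u i * g i) q t′ ≈⟨ lincomb-cong q (λ i → *-congˡ (g≈tρ i)) t′ ⟩
        lincomb (λ i → indicator u i * (t * ρ i)) q t′
          ≈⟨ lincomb-cong q (λ i → solve 3 (λ a t r → a :* (t :* r) := t :* (a :* r)) refl (indicator u i) t (ρ i)) t′ ⟩
        lincomb (λ i → t * (indicator u i * ρ i)) q t′ ≈⟨ lincomb-scale t _ q t′ ⟩
        t * canonical u t′                       ∎
      where
      t : Carrier
      t = g o * ρo⁻¹
      g≈tρ : ∀ i → g i ≈ t * ρ i
      g≈tρ i = begin
        g i                      ≈⟨ sym (*-identityˡ (g i)) ⟩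
        1# * g i                 ≈⟨ *-congʳ (sym ρoρo⁻¹≈1) ⟩
        (ρ o * ρo⁻¹) * g i       ≈⟨ solve 3 (λ r r⁻¹ g → (r :* r⁻¹) :* g := r⁻¹ :* (r :* g)) refl (ρ o) ρo⁻¹ (g i) ⟩
        ρo⁻¹ * (ρ o * g i)       ≈⟨ *-congˡ (sym (relations-proportional {g} g-rel ρ-rel o i)) ⟩
        ρo⁻¹ * (g o * ρ i)       ≈⟨ solve 3 (λ r⁻¹ g r → r⁻¹ :* (g :* r) := (g :* r⁻¹) :* r) refl ρo⁻¹ (g o) (ρ i) ⟩
        t * ρ i                  ∎

    -- If f·ρ is a relation then f is constant, since f·ρ is proportional to ρ.
    constant-ratio : ∀ {f : Fin n → Carrier} → IsRelation (λ i → f i * ρ i) → ∀ i i′ → f i ≈ f i′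
    constant-ratio {f} fρ-rel i i′ = *-cancelˡ (ρ-nonzero i′) (*-cancelˡ (ρ-nonzero i) (begin
      ρ i * (ρ i′ * f i)     ≈⟨ solve 3 (λ a b x → a :* (b :* x) := (x :* a) :* b) refl (ρ i) (ρ i′) (f i) ⟩
      (f i * ρ i) * ρ i′     ≈⟨ relations-proportional {λ i → f i * ρ i} fρ-rel ρ-rel i i′ ⟩
      ρ i * (f i′ * ρ i′)    ≈⟨ *-congˡ (*-comm (f i′) (ρ i′)) ⟩
      ρ i * (ρ i′ * f i′)    ∎))

module BlockCombinatorics where
  open import Data.Nat using (_+_; _*_)
  open ≡ using (refl; sym; trans; cong; cong₂; subst)

  Disjoint : ∀ {n} → Subset n → Subset n → Set
  Disjoint p q = ∀ {x} → x ∈ p → x ∉ q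

  ∩≡∅⇒disjoint : ∀ {n} {p q : Subset n} → p ∩ q ≡ ∅ → Disjoint p q
  ∩≡∅⇒disjoint p∩q≡∅ x∈p x∈q = ∉⊥ (subst (_ ∈_) p∩q≡∅ (x∈p∩q⁺ (x∈p , x∈q)))

  ∣∪∣-disjoint : ∀ {n} (p q : Subset n) → Disjoint p q → ∣ p ∪ q ∣ ≡ ∣ p ∣ + ∣ q ∣
  ∣∪∣-disjoint []             []             _   = refl
  ∣∪∣-disjoint (inside ∷ p)  (inside ∷ q)  dis = ⊥-elim (dis here here)
  ∣∪∣-disjoint (inside ∷ p)  (outside ∷ q) dis = cong suc (∣∪∣-disjoint p q (λ x∈p x∈q → dis (there x∈p) (there x∈q)))
  ∣∪∣-disjoint (outside ∷ p) (inside ∷ q)  dis =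
    trans (cong suc (∣∪∣-disjoint p q (λ x∈p x∈q → dis (there x∈p) (there x∈q)))) (sym (ℕ.+-suc ∣ p ∣ ∣ q ∣))
  ∣∪∣-disjoint (outside ∷ p) (outside ∷ q) dis = ∣∪∣-disjoint p q (λ x∈p x∈q → dis (there x∈p) (there x∈q))

  positive⇒nonempty : ∀ {n} {p : Subset n} → 0 < ∣ p ∣ → Nonempty p
  positive⇒nonempty {n} {p} 0<∣p∣ with nonempty? p
  ... | yes nonempty = nonempty
  ... | no empty = contradiction (sym (trans (cong ∣_∣ (Empty-unique empty)) (∣⊥∣≡0 n))) (ℕ.<⇒≢ 0<∣p∣)

  ⋃ᶠ : ∀ {n} t → (Fin t → Subset n) → Subset n
  ⋃ᶠ zero    f = ∅
  ⋃ᶠ (suc t) f = f zero ∪ ⋃ᶠ t (f ∘ suc)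

  ∈⋃ᶠ : ∀ {n} t (f : Fin t → Subset n) {x} → x ∈ ⋃ᶠ t f → Σ (Fin t) (λ j → x ∈ f j)
  ∈⋃ᶠ zero    f x∈⋃ = ⊥-elim (∉⊥ x∈⋃)
  ∈⋃ᶠ (suc t) f x∈⋃ with x∈p∪q⁻ (f zero) (⋃ᶠ t (f ∘ suc)) x∈⋃
  ... | inj₁ x∈f₀ = zero , x∈f₀
  ... | inj₂ x∈⋃′ with ∈⋃ᶠ t (f ∘ suc) x∈⋃′
  ...   | j , x∈fj = suc j , x∈fj

  ∣⋃ᶠ∣ : ∀ {n} k t (f : Fin t → Subset n) → (∀ j → ∣ f j ∣ ≡ k) →
         (∀ {i j x} → x ∈ f i → x ∈ f j → i ≡ j) → ∣ ⋃ᶠ t f ∣ ≡ t * k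
  ∣⋃ᶠ∣ {n} k zero    f sizes pairwise = ∣⊥∣≡0 n
  ∣⋃ᶠ∣     k (suc t) f sizes pairwise = trans
    (∣∪∣-disjoint (f zero) (⋃ᶠ t (f ∘ suc)) disjoint)
    (cong₂ _+_ (sizes zero) (∣⋃ᶠ∣ k t (f ∘ suc) (sizes ∘ suc) (λ x∈fi x∈fj → suc-injective (pairwise x∈fi x∈fj))))
    where
    disjoint : Disjoint (f zero) (⋃ᶠ t (f ∘ suc))
    disjoint x∈f₀ x∈⋃ with ∈⋃ᶠ t (f ∘ suc) x∈⋃
    ... | j , x∈fj with pairwise x∈f₀ x∈fj
    ...   | ()

  module BlockFacts {n k s m : ℕ} (B : Block n k s m) where
    open Block B

    member : Fin s → Subset n
    member j = a j ∪ d

    a-pairwise : ∀ {i j x} → x ∈ a i → x ∈ a j → i ≡ j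
    a-pairwise {i} {j} x∈ai x∈aj with i ≟ j
    ... | yes i≡j = i≡j
    ... | no  i≢j = ⊥-elim (∩≡∅⇒disjoint (a-disj i j i≢j) x∈ai x∈aj)

    a-d-disjoint : ∀ {j} → Disjoint (a j) d
    a-d-disjoint {j} = ∩≡∅⇒disjoint (ad-disj j)

    member-size : ∀ j → ∣ member j ∣ ≡ k + m
    member-size j = trans (∣∪∣-disjoint (a j) d a-d-disjoint) (cong₂ _+_ (a-size j) d-size)

    a-nonempty : 0 < k → ∀ j → Nonempty (a j)
    a-nonempty 0<k j = positive⇒nonempty (subst (0 <_) (sym (a-size j)) 0<k)

    d-nonempty : 0 < m → Nonempty d
    d-nonempty 0<m = positive⇒nonempty (subst (0 <_) (sym d-size) 0<m)

    covers : n ≡ k * s + m → ∀ x → x ∈ d ⊎ Σ (Fin s) (λ j → x ∈ a j)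
    covers n≡ks+m x with x∈p∪q⁻ (⋃ᶠ s a) d (subst (x ∈_) (sym parts≡X) ∈⊤)
      where
      parts≡X : ⋃ᶠ s a ∪ d ≡ ⊤
      parts≡X = ∣p∣≡n⇒p≡⊤ (begin
        ∣ ⋃ᶠ s a ∪ d ∣      ≡⟨ ∣∪∣-disjoint (⋃ᶠ s a) d (λ x∈⋃ → a-d-disjoint {proj₁ (∈⋃ᶠ s a x∈⋃)} (proj₂ (∈⋃ᶠ s a x∈⋃))) ⟩
        ∣ ⋃ᶠ s a ∣ + ∣ d ∣  ≡⟨ cong₂ _+_ (∣⋃ᶠ∣ k s a a-size a-pairwise) d-size ⟩
        s * k + m          ≡⟨ cong (_+ m) (ℕ.*-comm s k) ⟩
        k * s + m          ≡⟨ sym n≡ks+m ⟩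
        n                  ∎)
        where open ≡.≡-Reasoning
    ... | inj₁ x∈⋃ = inj₂ (∈⋃ᶠ s a x∈⋃)
    ... | inj₂ x∈d = inj₁ x∈d

  -- The standard block on X = Fin (k·s + m), viewed as k copies of Fin s followed by
  -- Fin m: a_i consists of the k copies of i, and d is the final Fin m.
  module StandardBlock where

    repeat : ∀ {s} k → Subset s → Subset (k * s)
    repeat k u = concat (replicate k u)

    ∣++∣ : ∀ {a b} (p : Subset a) (q : Subset b) → ∣ p ++ q ∣ ≡ ∣ p ∣ + ∣ q ∣
    ∣++∣ []            q = refl
    ∣++∣ (inside ∷ p)  q = cong suc (∣++∣ p q)
    ∣++∣ (outside ∷ p) q = ∣++∣ p q

    ∣repeat∣ : ∀ {s} k (u : Subset s) → ∣ repeat k u ∣ ≡ k * ∣ u ∣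
    ∣repeat∣ zero    u = refl
    ∣repeat∣ (suc k) u = trans (∣++∣ u (repeat k u)) (cong (∣ u ∣ +_) (∣repeat∣ k u))

    ∩-++ : ∀ {a b} (p p′ : Subset a) (q q′ : Subset b) → (p ++ q) ∩ (p′ ++ q′) ≡ (p ∩ p′) ++ (q ∩ q′)
    ∩-++ p p′ q q′ = zipWith-++ _ p q p′ q′

    repeat-∩ : ∀ {s} k (u v : Subset s) → repeat k u ∩ repeat k v ≡ repeat k (u ∩ v)
    repeat-∩ zero    u v = refl
    repeat-∩ (suc k) u v = trans (∩-++ u v (repeat k u) (repeat k v)) (cong ((u ∩ v) ++_) (repeat-∩ k u v))

    ∅++∅ : ∀ a b → ∅ {a} ++ ∅ {b} ≡ ∅
    ∅++∅ zero    b = refl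
    ∅++∅ (suc a) b = cong (outside ∷_) (∅++∅ a b)

    repeat-∅ : ∀ k s → repeat k (∅ {s}) ≡ ∅
    repeat-∅ zero    s = refl
    repeat-∅ (suc k) s = trans (cong (∅ ++_) (repeat-∅ k s)) (∅++∅ s (k * s))

    layout-disjoint : ∀ k {s m} {u v : Subset s} {y z : Subset m} → u ∩ v ≡ ∅ → y ∩ z ≡ ∅ →
      (repeat k u ++ y) ∩ (repeat k v ++ z) ≡ ∅
    layout-disjoint k {s} {m} {u} {v} {y} {z} u∩v≡∅ y∩z≡∅ = begin
      (repeat k u ++ y) ∩ (repeat k v ++ z)   ≡⟨ ∩-++ (repeat k u) (repeat k v) y z ⟩
      (repeat k u ∩ repeat k v) ++ (y ∩ z)    ≡⟨ cong₂ _++_ (trans (repeat-∩ k u v) (cong (repeat k) u∩v≡∅)) y∩z≡∅ ⟩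
      repeat k ∅ ++ ∅                         ≡⟨ cong (_++ ∅ {m}) (repeat-∅ k s) ⟩
      ∅ {k * s} ++ ∅                          ≡⟨ ∅++∅ (k * s) m ⟩
      ∅                                       ∎
      where open ≡.≡-Reasoning

    singletons-disjoint : ∀ {s} {i j : Fin s} → i ≢ j → ⁅ i ⁆ ∩ ⁅ j ⁆ ≡ ∅
    singletons-disjoint {i = i} {j} i≢j = Empty-unique λ where
      (x , x∈i∩j) → let (x∈i , x∈j) = x∈p∩q⁻ ⁅ i ⁆ ⁅ j ⁆ x∈i∩j
                    in i≢j (trans (sym (x∈⁅y⁆⇒x≡y i x∈i)) (x∈⁅y⁆⇒x≡y j x∈j))

    standardBlock : ∀ k s m → Block (k * s + m) k s m
    standardBlock k s m = record
      { a       = λ i → repeat k ⁅ i ⁆ ++ ∅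
      ; d       = repeat k ∅ ++ ⊤
      ; a-size  = λ i → begin
          ∣ repeat k ⁅ i ⁆ ++ ∅ ∣  ≡⟨ ∣++∣ (repeat k ⁅ i ⁆) ∅ ⟩
          ∣ repeat k ⁅ i ⁆ ∣ + ∣ ∅ {m} ∣ ≡⟨ cong₂ _+_ (trans (∣repeat∣ k ⁅ i ⁆) (cong (k *_) (∣⁅x⁆∣≡1 i))) (∣⊥∣≡0 m) ⟩
          k * 1 + 0               ≡⟨ trans (ℕ.+-identityʳ (k * 1)) (ℕ.*-identityʳ k) ⟩
          k                       ∎
      ; d-size  = begin
          ∣ repeat k ∅ ++ ⊤ ∣      ≡⟨ ∣++∣ (repeat k ∅) ⊤ ⟩
          ∣ repeat k (∅ {s}) ∣ + ∣ ⊤ {m} ∣ ≡⟨ cong₂ _+_ (trans (∣repeat∣ k ∅) (cong (k *_) (∣⊥∣≡0 s))) (∣⊤∣≡n m) ⟩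
          k * 0 + m               ≡⟨ cong (_+ m) (ℕ.*-zeroʳ k) ⟩
          m                       ∎
      ; a-disj  = λ i j i≢j → layout-disjoint k (singletons-disjoint i≢j) (∩-zeroˡ ∅)
      ; ad-disj = λ i → layout-disjoint k (∩-zeroʳ ⁅ i ⁆) (∩-zeroˡ ⊤)
      }
      where open ≡.≡-Reasoning

-- A block of CR(X,k,s), s = r+1, whose members c_j = a_j ∪ d are represented by vectors
-- w_j of the points p_{c_j}.
module BlockRepresentation {c ℓ : Level} (F : Field c ℓ) {D n k r m : ℕ}
  (q : Fin n → LinAlg.Vect F D) (frame : LinAlg.IsFrame F q)
  (B : Block n k (suc r) m) (0<k : 0 < k) (0<m : 0 < m)
  (w : Fin (suc r) → LinAlg.Vect F D)
  (represents : ∀ j → LinAlg.RepresentsP F q (BlockCombinatorics.BlockFacts.member B j) (w j)) where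
  open Field F hiding (zero)
  open LinAlg F
  open LinearAlgebra F
  open FrameRelations F q frame
  open Block B
  open BlockCombinatorics.BlockFacts B
  open import Algebra.Properties.Ring ring using (-‿distribˡ-*; -‿distribʳ-*; -‿involutive; +-inverseʳ-unique; +-identityʳ-unique)
  open import Algebra.Solver.Ring.NaturalCoefficients.Default commutativeSemiring
  open import Relation.Binary.Reasoning.Setoid setoid

  ρ : Fin n → Carrier
  ρ = proj₁ (representative-relation (represents zero))

  ρ-rel : IsRelation ρ
  ρ-rel = proj₁ (proj₂ (representative-relation (represents zero)))

  ρ-nonzero : ∀ i → ¬ ρ i ≈ 0#
  ρ-nonzero = proj₁ (proj₂ (proj₂ (representative-relation (represents zero))))

  open Normalised ρ-rel ρ-nonzero

  o : Fin n
  o = proj₁ (d-nonempty 0<m)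

  o∈d : o ∈ d
  o∈d = proj₂ (d-nonempty 0<m)

  t : Fin (suc r) → Carrier
  t j = proj₁ (representative-multiple o (represents j))

  t-nonzero : ∀ j → ¬ t j ≈ 0#
  t-nonzero j = proj₁ (proj₂ (representative-multiple o (represents j)))

  w≈tP : ∀ j t′ → w j t′ ≈ t j * canonical (member j) t′
  w≈tP j = proj₂ (proj₂ (representative-multiple o (represents j)))

  weight : (Fin (suc r) → Carrier) → Fin n → Carrier
  weight y i = sum (λ j → y j * indicator (member j) i)

  -- A point of a_j lies in the member c_j only,
  weight-on-a : ∀ y {j x} → x ∈ a j → weight y x ≈ y j
  weight-on-a y {j} {x} x∈aj = begin
    weight y x                            ≈⟨ sum-single j (λ i i≢j → trans (*-congˡ (iverson-no (x∉ci i≢j) (x ∈? member i))) (zeroʳ (y i))) ⟩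
    y j * indicator (member j) x          ≈⟨ *-congˡ (iverson-yes (x∈p∪q⁺ (inj₁ x∈aj)) (x ∈? member j)) ⟩
    y j * 1#                              ≈⟨ *-identityʳ (y j) ⟩
    y j                                   ∎
    where
    x∉ci : ∀ {i} → i ≢ j → x ∉ member i
    x∉ci i≢j x∈ci with x∈p∪q⁻ (a _) d x∈ci
    ... | inj₁ x∈ai = i≢j (a-pairwise x∈ai x∈aj)
    ... | inj₂ x∈d  = a-d-disjoint x∈aj x∈d

  -- while a point of d lies in every member.
  weight-on-d : ∀ y {x} → x ∈ d → weight y x ≈ sum y
  weight-on-d y {x} x∈d = sum-cong-≋ {suc r} λ j →
    trans (*-congˡ (iverson-yes (x∈p∪q⁺ {p = a j} (inj₂ x∈d)) (x ∈? member j))) (*-identityʳ (y j))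

  combination-canonical : ∀ y t′ →
    sum (λ j → y j * canonical (member j) t′) ≈ lincomb (λ i → weight y i * ρ i) q t′
  combination-canonical y t′ = trans (lincomb-lincomb y (λ j i → indicator (member j) i * ρ i) q t′)
    (lincomb-cong q (λ i → trans (sum-cong-≋ {suc r} (λ j → sym (*-assoc (y j) (indicator (member j) i) (ρ i))))
                                 (sym (*-distribʳ-sum (ρ i) (λ j → y j * indicator (member j) i)))) t′)

  -- Key lemma: if Σ_j y_j P(c_j) = 0 then σ_y·ρ is a relation, so σ_y is constant;
  -- comparing its values on a_j and on d gives y_j = Σ_j y_j for every j.
  balanced : ∀ y → (∀ t′ → sum (λ j → y j * canonical (member j) t′) ≈ 0#) → ∀ j → y j ≈ sum y
  balanced y vanishes j = begin
    y j          ≈⟨ sym (weight-on-a y x∈aj) ⟩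
    weight y x   ≈⟨ constant-ratio {weight y} (λ t′ → trans (sym (combination-canonical y t′)) (vanishes t′)) x o ⟩
    weight y o   ≈⟨ weight-on-d y o∈d ⟩
    sum y        ∎
    where
    x : Fin n
    x = proj₁ (a-nonempty 0<k j)
    x∈aj : x ∈ a j
    x∈aj = proj₂ (a-nonempty 0<k j)

  dependency-balanced : ∀ y → lincomb y w ≈ᵥ 0ᵥ → ∀ j → y j * t j ≈ sum (λ j → y j * t j)
  dependency-balanced y dependency = balanced (λ j → y j * t j) λ t′ → begin
    sum (λ j → y j * t j * canonical (member j) t′)   ≈⟨ sum-cong-≋ {suc r} (λ j → trans (*-assoc (y j) (t j) _) (*-congˡ (sym (w≈tP j t′)))) ⟩
    sum (λ j → y j * w j t′)                          ≡⟨ ≡.sym (sumF≡sum (suc r) (λ j → y j * w j t′)) ⟩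
    lincomb y w t′                                    ≈⟨ dependency t′ ⟩
    0#                                                ∎

  -- (i) If (s-1)·1 ≠ 0, the s representatives are independent: balanced numbers z_j
  -- satisfy Σ z = s·Σ z, i.e. (s-1)·Σ z = 0, so they all vanish.
  independent : ¬ CharDivides r → LinIndep w
  independent r≉0 y dependency j =
    *-zero-cancelˡ (t-nonzero j) (trans (*-comm (t j) (y j)) (trans (balanced′ j) S≈0))
    where
    S : Carrier
    S = sum (λ j → y j * t j)
    balanced′ : ∀ j → y j * t j ≈ S
    balanced′ = dependency-balanced y dependency
    S≈S+rS : S + natMul r * S ≈ S
    S≈S+rS = sym (begin
      S                        ≈⟨ sum-cong-≋ {suc r} balanced′ ⟩
      sum {suc r} (λ _ → S)    ≈⟨ sum-const (suc r) S ⟩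
      (1# + natMul r) * S      ≈⟨ distribʳ S 1# (natMul r) ⟩
      1# * S + natMul r * S    ≈⟨ +-congʳ (*-identityˡ S) ⟩
      S + natMul r * S         ∎)
    S≈0 : S ≈ 0#
    S≈0 = *-zero-cancelˡ r≉0 (+-identityʳ-unique S (natMul r * S) S≈S+rS)

  module Spanning (r≈0 : CharDivides r) (covers : ∀ x → x ∈ d ⊎ Σ (Fin (suc r)) (λ j → x ∈ a j)) where

    -- Every point of X is contained in 1 ≡ s (mod char F) members.
    multiplicity-one : ∀ i → weight (λ _ → 1#) i ≈ 1#
    multiplicity-one i with covers i
    ... | inj₂ (j , i∈aj) = weight-on-a (λ _ → 1#) i∈aj
    ... | inj₁ i∈d = begin
      weight (λ _ → 1#) i    ≈⟨ weight-on-d (λ _ → 1#) i∈d ⟩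
      sum {suc r} (λ _ → 1#) ≈⟨ sum-const (suc r) 1# ⟩
      (1# + natMul r) * 1#   ≈⟨ *-identityʳ _ ⟩
      1# + natMul r          ≈⟨ +-congˡ r≈0 ⟩
      1# + 0#                ≈⟨ +-identityʳ 1# ⟩
      1#                     ∎

    members-sum-zero : ∀ t′ → sum (λ j → canonical (member j) t′) ≈ 0#
    members-sum-zero t′ = begin
      sum (λ j → canonical (member j) t′)        ≈⟨ sum-cong-≋ {suc r} (λ j → sym (*-identityˡ (canonical (member j) t′))) ⟩
      sum (λ j → 1# * canonical (member j) t′)   ≈⟨ combination-canonical (λ _ → 1#) t′ ⟩
      lincomb (λ i → weight (λ _ → 1#) i * ρ i) q t′ ≈⟨ lincomb-cong q (λ i → trans (*-congʳ (multiplicity-one i)) (*-identityˡ (ρ i))) t′ ⟩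
      lincomb ρ q t′                             ≈⟨ ρ-rel t′ ⟩
      0#                                         ∎

    -- A dependency among w_1,…,w_{s-1} is a dependency among all w_j with y_0 = 0; its
    -- balanced numbers then all equal y_0 t_0 = 0.
    basis-independent : LinIndep (w ∘ suc)
    basis-independent x dependency j =
      *-zero-cancelˡ (t-nonzero (suc j)) (trans (*-comm _ (x j)) (trans (balanced′ (suc j)) S≈0))
      where
      y : Fin (suc r) → Carrier
      y zero    = 0#
      y (suc j) = x j
      balanced′ : ∀ j → y j * t j ≈ sum (λ j → y j * t j)
      balanced′ = dependency-balanced y (λ t′ → trans (+-congʳ (zeroˡ (w zero t′))) (trans (+-identityˡ _) (dependency t′)))
      S≈0 : sum (λ j → y j * t j) ≈ 0#
      S≈0 = trans (sym (balanced′ zero)) (zeroˡ (t zero))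

    -- w_0 = t_0 P(c_0) = -t_0 Σ_{j≥1} P(c_j) = Σ_{j≥1} (-t_0 / t_j) w_j.
    first-in-span : InSpan (w ∘ suc) (w zero)
    first-in-span = coef , λ t′ → sym (begin
      lincomb coef (w ∘ suc) t′                            ≡⟨ sumF≡sum r (λ j → coef j * w (suc j) t′) ⟩
      sum (λ j → coef j * w (suc j) t′)                    ≈⟨ sum-cong-≋ {r} (λ j → term j t′) ⟩
      sum (λ j → - t zero * canonical (member (suc j)) t′) ≈⟨ sym (*-distribˡ-sum (- t zero) (λ j → canonical (member (suc j)) t′)) ⟩
      - t zero * sum (λ j → canonical (member (suc j)) t′) ≈⟨ *-congˡ (+-inverseʳ-unique _ _ (members-sum-zero t′)) ⟩
      - t zero * - canonical (member zero) t′              ≈⟨ sym (-‿distribˡ-* (t zero) _) ⟩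
      - (t zero * - canonical (member zero) t′)            ≈⟨ -‿cong (sym (-‿distribʳ-* (t zero) _)) ⟩
      - - (t zero * canonical (member zero) t′)            ≈⟨ -‿involutive _ ⟩
      t zero * canonical (member zero) t′                  ≈⟨ sym (w≈tP zero t′) ⟩
      w zero t′                                            ∎)
      where
      t⁻¹ : Fin r → Carrier
      t⁻¹ j = proj₁ (inverse (t (suc j)) (t-nonzero (suc j)))
      coef : Fin r → Carrier
      coef j = - t zero * t⁻¹ j
      term : ∀ j t′ → coef j * w (suc j) t′ ≈ - t zero * canonical (member (suc j)) t′
      term j t′ = begin
        coef j * w (suc j) t′                              ≈⟨ *-congˡ (w≈tP (suc j) t′) ⟩
        (- t zero * t⁻¹ j) * (t (suc j) * P)               ≈⟨ solve 4 (λ a b c p → (a :* b) :* (c :* p) := a :* ((c :* b) :* p)) refl (- t zero) (t⁻¹ j) (t (suc j)) P ⟩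
        - t zero * ((t (suc j) * t⁻¹ j) * P)               ≈⟨ *-congˡ (trans (*-congʳ (proj₂ (inverse (t (suc j)) (t-nonzero (suc j))))) (*-identityˡ P)) ⟩
        - t zero * P                                       ∎
        where
        P : Carrier
        P = canonical (member (suc j)) t′

    dimension : HasVecDim w r
    dimension = w ∘ suc , ((λ j → member-in-span w (suc j)) , basis-independent) , λ where
      zero    → first-in-span
      (suc j) → member-in-span (w ∘ suc) j

open import Data.Nat using (_+_; _*_)
open BlockCombinatorics using (module BlockFacts)
open BlockCombinatorics.StandardBlock using (standardBlock)

proposition2p11 : ∀ {c ℓ : Level} (F : Field c ℓ) (k s m : ℕ) →
    1 ≤ k → 2 ≤ s → 0 < m → 5 ≤ k * s + m →
    let open LinAlg F
        n = k * s + m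
    in (q : Fin n → Vect (n ∸ 1)) → IsFrame q →
       (p : Subset n → Vect (n ∸ 1)) →
       (∀ u → ∣ u ∣ ≡ k + m → RepresentsP q u (p u)) →
       ((¬ CharDivides (s ∸ 1) →
          Σ (Block n k s m) (λ B →
            ¬ HasProjDim (λ i → p (Block.a B i ∪ Block.d B)) (s ∸ 2)))
       × (CharDivides (s ∸ 1) →
          ∀ (B : Block n k s m) →
            HasProjDim (λ i → p (Block.a B i ∪ Block.d B)) (s ∸ 2)))
proposition2p11 F k (suc (suc s′)) m 0<k (s≤s (s≤s z≤n)) 0<m _ q frame p p-represents =
  -- (i) the standard block has s independent points, so its span is not (s-2)-dimensional
  (λ char∤ → standardBlock k s m ,
     LinearAlgebra.independent⇒¬HasVecDim F (ℕ.n<1+n (suc s′)) (Represented.independent (standardBlock k s m) char∤))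
  , λ char∣ B → Represented.Spanning.dimension B char∣ (BlockFacts.covers B ≡.refl)
  where
  s : ℕ
  s = suc (suc s′)
  module Represented (B : Block (k * s + m) k s m) = BlockRepresentation F q frame B 0<k 0<m
    (λ j → p (BlockFacts.member B j)) (λ j → p-represents _ (BlockFacts.member-size B j))
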